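{- In the skeleton $T$: (1) every supernode has exactly $\Lambda$ children; (2) every non-leaf node that is not a supernode has exactly $\Lambda_{j+1}$ children, where $j$ is the distance from the node to its nearest ancestor-or-self that is not of type $0$ (so $j=0$ if the node itself is not of type $0$).
   Context: Fix nonnegative integers $\lambda_1,\lambda_2,\dots$ and an integer $k\ge1$ (the order) such that $\lambda_1\ge1$, $\lambda_k\ge1$, $\lambda_i=0$ for all $i>k$, and $\lambda_1\ge2$ if $k=1$. For $j\ge0$ let $\Lambda_j=\sum_{i=1}^j\lambda_i$ and $\Lambda=\Lambda_k$. All trees are ordered (children ordered left to right). The type of a node is the number of siblings to its left. Define finite trees $T_j$: $T_0$ is a single node. For $j\ge1$, $T_j$ has a chain of special nodes $s_j$ (root), $s_{j-1},\dots,s_0$ with $s_i$ on level $i$ and $s_{i-1}$ the leftmost child of $s_i$; for $1\le i\le j$, $s_i$ has $\Lambda_{j-i+1}$ children: $s_{i-1}$ followed by $\Lambda_{j-i+1}-1$ roots of copies of $T_{i-1}$. The skeleton $T$ is the infinite rootless tree with special nodes $u_0,u_1,\dots$, where $u_0$ is a leaf on level $0$, $u_{i-1}$ is the leftmost child of $u_i$, and for $i\ge1$ the $i$-th supernode $u_i$ has, to the right of $u_{i-1}$, exactly $\Lambda-1$ further children, each the root of a copy of $T_{i-1}$. The supernodes are $u_1,u_2,\dots$. -}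

module Defs where

open import Data.Nat using (ℕ; zero; suc; _+_; _∸_; _≤_; _<_)
open import Data.List using (List; []; _∷_; length; replicate)
open import Data.Maybe using (Maybe; just; nothing)
open import Data.Product using (_×_; _,_; ∃)
open import Data.Empty using (⊥)
open import Relation.Binary.PropositionalEquality using (_≡_)
open import Relation.Nullary using (¬_)

-- Parameters: λ is a sequence λ₁, λ₂, … (λ 0 is ignored), k the order.

Λ : (ℕ → ℕ) → ℕ → ℕ
Λ lam zero    = 0
Λ lam (suc j) = Λ lam j + lam (suc j)

record Admissible (lam : ℕ → ℕ) (k : ℕ) : Set where
  field
    k≥1      : 1 ≤ k
    λ₁≥1     : 1 ≤ lam 1
    λk≥1     : 1 ≤ lam k
    λ-vanish : ∀ i → k < i → lam i ≡ 0
    k1⇒λ₁≥2  : k ≡ 1 → 2 ≤ lam 1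

data Tree : Set where
  node : List Tree → Tree

children : Tree → List Tree
children (node ts) = ts

numChildren : Tree → ℕ
numChildren t = length (children t)

-- i-th child (0-based, i.e. the child of type i)
nth : List Tree → ℕ → Maybe Tree
nth []       _       = nothing
nth (t ∷ ts) zero    = just t
nth (t ∷ ts) (suc i) = nth ts i

at : Tree → List ℕ → Maybe Tree
at t [] = just t
at (node ts) (i ∷ p) with nth ts i
... | nothing = nothing
... | just t' = at t' p

leaf : Tree
leaf = node []

-- The trees T_j.
-- spine lam j i is the subtree of T_j rooted at the special node s_i
-- (i ≤ j); s_{i+1} has Λ_{j-i} children: s_i followed by Λ_{j-i} - 1
-- copies of T_i.

mutual
  Tj : (ℕ → ℕ) → ℕ → Tree
  Tj lam j = spine lam j j

  spine : (ℕ → ℕ) → ℕ → ℕ → Tree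
  spine lam j zero    = leaf
  spine lam j (suc i) =
    node (spine lam j i ∷ replicate (Λ lam (j ∸ i) ∸ 1) (Tj lam i))

-- The skeleton T (infinite, rootless).
-- U lam k n is the (finite) subtree of T rooted at the special node u_n:
-- u_0 is a leaf, u_{n+1} has children u_n followed by Λ - 1 copies of T_n.

U : (ℕ → ℕ) → ℕ → ℕ → Tree
U lam k zero    = leaf
U lam k (suc n) = node (U lam k n ∷ replicate (Λ lam k ∸ 1) (Tj lam n))

-- A node of T is presented as (n , p): the node reached from u_n along
-- the path p (child indices, root first).  It must be a valid path, i.e.
-- at (U lam k n) p ≡ just t for some t.  Different presentations of the
-- same node are identified via lift (u_n is the leftmost child of u_{n+1}).

Pos : Set
Pos = ℕ × List ℕ

lift : Pos → Pos
lift (n , p) = (suc n , 0 ∷ p)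

liftN : ℕ → Pos → Pos
liftN zero    x = x
liftN (suc a) x = liftN a (lift x)

SameNode : Pos → Pos → Set
SameNode x y = ∃ λ a → ∃ λ b → liftN a x ≡ liftN b y

IsSupernode : Pos → Set
IsSupernode x = ∃ λ m → 1 ≤ m × SameNode x (m , [])

-- type of a node = number of siblings to its left = its last child index;
-- u_n (empty path) is the leftmost child of u_{n+1}, hence type 0.
lastOr : ℕ → List ℕ → ℕ
lastOr d []       = d
lastOr d (x ∷ xs) = lastOr x xs

typeOf : Pos → ℕ
typeOf (n , p) = lastOr 0 p

dropLast : List ℕ → List ℕ
dropLast []           = []
dropLast (x ∷ [])     = []
dropLast (x ∷ y ∷ xs) = x ∷ dropLast (y ∷ xs)

parent : Pos → Pos
parent (n , []) = (suc n , [])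
parent (n , p)  = (n , dropLast p)

ancestor : ℕ → Pos → Pos
ancestor zero    x = x
ancestor (suc i) x = parent (ancestor i x)

NearestNonZeroDist : Pos → ℕ → Set
NearestNonZeroDist x j =
  ¬ (typeOf (ancestor j x) ≡ 0) × (∀ i → i < j → typeOf (ancestor i x) ≡ 0)

module Submission where

open import Defs
open import Data.Nat using (ℕ; zero; suc; _+_; _∸_; _≤_; _<_; s≤s; z≤n)
open import Data.Nat.Properties
  using (+-suc; +-assoc; +-identityʳ; +-cancelˡ-≡; m+n∸n≡m; m+[n∸m]≡n; m≤m+n; ≤-trans; 0≢1+n)
open import Data.List using (List; []; _∷_; _++_; replicate; length)
open import Data.List.Properties using (∷-injectiveʳ; ++-identityʳ; length-replicate)
open import Data.Maybe using (just; nothing)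
open import Data.Maybe.Properties using (just-injective)
open import Data.Product using (_×_; _,_; ∃)
open import Data.Product.Properties using (,-injective)
open import Data.Empty using (⊥-elim)
open import Function using (case_of_)
open import Relation.Binary.PropositionalEquality using (_≡_; refl; sym; trans; cong; cong₂)
open import Relation.Nullary using (¬_)

-- Write a path p from u_n as  q ++ a ∷ 0 ⋯ 0.  If it has no non-zero entry, it
-- runs down the leftmost chain u_n, u_{n-1}, …, so the node is a supernode or
-- the leaf u_0.  Otherwise, once the path leaves a leftmost chain through a
-- child of type a > 0 it is inside a copy of some T_m, and the final run of j
-- zeros goes down the special chain of that copy to s_{m-j}; if this is a
-- non-leaf s_{r+1}, it has Λ_{m-r} = Λ_{j+1} children, and the last non-zero
-- entry of the path is exactly the ancestor j levels up.

zeros : ℕ → List ℕ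
zeros c = replicate c 0

replicate-++-∷ : ∀ {A : Set} n (x : A) xs → replicate n x ++ x ∷ xs ≡ x ∷ replicate n x ++ xs
replicate-++-∷ zero    x xs = refl
replicate-++-∷ (suc n) x xs = cong (x ∷_) (replicate-++-∷ n x xs)

replicate-++-suffix : ∀ {A : Set} a b (x : A) xs → replicate a x ++ xs ≡ replicate b x →
  ∃ λ c → xs ≡ replicate c x × a + c ≡ b
replicate-++-suffix zero    b       x xs eq = b , eq , refl
replicate-++-suffix (suc a) zero    x xs ()
replicate-++-suffix (suc a) (suc b) x xs eq with replicate-++-suffix a b x xs (∷-injectiveʳ eq)
... | c , xs≡ , a+c≡b = c , xs≡ , cong suc a+c≡b

data ZerosView : List ℕ → Set where
  all-zero           : ∀ c → ZerosView (zeros c)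
  nonzero-then-zeros : ∀ q a j → ZerosView (q ++ suc a ∷ zeros j)

zerosView : ∀ p → ZerosView p
zerosView [] = all-zero 0
zerosView (x ∷ p) with zerosView p
zerosView (zero  ∷ .(zeros c))              | all-zero c = all-zero (suc c)
zerosView (suc a ∷ .(zeros c))              | all-zero c = nonzero-then-zeros [] a c
zerosView (x     ∷ .(q ++ suc a ∷ zeros j)) | nonzero-then-zeros q a j = nonzero-then-zeros (x ∷ q) a j

lastOr-++-∷ : ∀ d xs y ys → lastOr d (xs ++ y ∷ ys) ≡ lastOr y ys
lastOr-++-∷ d []       y ys = refl
lastOr-++-∷ d (x ∷ xs) y ys = lastOr-++-∷ x xs y ys

lastOr-replicate : ∀ d n x → lastOr d (replicate (suc n) x) ≡ x
lastOr-replicate d zero    x = refl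
lastOr-replicate d (suc n) x = lastOr-replicate x n x

dropLast-++-∷ : ∀ xs (y : ℕ) ys → dropLast (xs ++ y ∷ ys) ≡ xs ++ dropLast (y ∷ ys)
dropLast-++-∷ []           y ys = refl
dropLast-++-∷ (x ∷ [])     y ys = refl
dropLast-++-∷ (x ∷ x′ ∷ xs) y ys = cong (x ∷_) (dropLast-++-∷ (x′ ∷ xs) y ys)

dropLast-∷-replicate : ∀ (y : ℕ) n x → dropLast (y ∷ replicate (suc n) x) ≡ y ∷ replicate n x
dropLast-∷-replicate y zero    x = refl
dropLast-∷-replicate y (suc n) x = cong (y ∷_) (dropLast-∷-replicate x n x)

liftN-≡ : ∀ a n p → liftN a (n , p) ≡ (a + n , zeros a ++ p)
liftN-≡ zero    n p = refl
liftN-≡ (suc a) n p = trans (liftN-≡ a (suc n) (0 ∷ p))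
                            (cong₂ _,_ (+-suc a n) (replicate-++-∷ a 0 p))

isSupernode⇒zeros : ∀ {n p} → IsSupernode (n , p) → ∃ λ c → ∃ λ m → p ≡ zeros c × n ≡ c + m × 1 ≤ m
isSupernode⇒zeros {n} {p} (m , 1≤m , a , b , e)
  with ,-injective (trans (sym (liftN-≡ a n p)) (trans e (liftN-≡ b m [])))
... | a+n≡b+m , zs++p≡zs++[]
  with replicate-++-suffix a b 0 p (trans zs++p≡zs++[] (++-identityʳ (zeros b)))
... | c , refl , refl = c , m , refl , +-cancelˡ-≡ a n (c + m) (trans a+n≡b+m (+-assoc a c m)) , 1≤m

zeros-isSupernode : ∀ c m → IsSupernode (c + suc m , zeros c)
zeros-isSupernode c m = suc m , s≤s z≤n , 0 , c ,
  sym (trans (liftN-≡ c (suc m) []) (cong (c + suc m ,_) (++-identityʳ (zeros c))))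

parent-++-∷ : ∀ n xs y ys → parent (n , xs ++ y ∷ ys) ≡ (n , dropLast (xs ++ y ∷ ys))
parent-++-∷ n []       y ys = refl
parent-++-∷ n (x ∷ xs) y ys = refl

ancestor-suc : ∀ i x → ancestor (suc i) x ≡ ancestor i (parent x)
ancestor-suc zero    x = refl
ancestor-suc (suc i) x = cong parent (ancestor-suc i x)

parent-trailing-zeros : ∀ n q a d → parent (n , q ++ a ∷ zeros (suc d)) ≡ (n , q ++ a ∷ zeros d)
parent-trailing-zeros n q a d =
  trans (parent-++-∷ n q a (zeros (suc d)))
        (cong (n ,_) (trans (dropLast-++-∷ q a (zeros (suc d)))
                            (cong (q ++_) (dropLast-∷-replicate a d 0))))

ancestor-trailing-zeros : ∀ n q a i d → ancestor i (n , q ++ a ∷ zeros (i + d)) ≡ (n , q ++ a ∷ zeros d)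
ancestor-trailing-zeros n q a zero    d = refl
ancestor-trailing-zeros n q a (suc i) d =
  trans (ancestor-suc i (n , q ++ a ∷ zeros (suc (i + d))))
        (trans (cong (ancestor i) (parent-trailing-zeros n q a (i + d)))
               (ancestor-trailing-zeros n q a i d))

nearestNonZeroDist-trailing-zeros : ∀ n q a j → NearestNonZeroDist (n , q ++ suc a ∷ zeros j) j
nearestNonZeroDist-trailing-zeros n q a j = nonzero-at-j , zero-below-j
  where
    typeOf-ancestor : ∀ i d {j′} → i + d ≡ j′ →
      typeOf (ancestor i (n , q ++ suc a ∷ zeros j′)) ≡ lastOr (suc a) (zeros d)
    typeOf-ancestor i d refl =
      trans (cong typeOf (ancestor-trailing-zeros n q (suc a) i d)) (lastOr-++-∷ 0 q (suc a) (zeros d))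

    nonzero-at-j : ¬ (typeOf (ancestor j (n , q ++ suc a ∷ zeros j)) ≡ 0)
    nonzero-at-j e = 0≢1+n (trans (sym e) (typeOf-ancestor j 0 (+-identityʳ j)))

    zero-below-j : ∀ i → i < j → typeOf (ancestor i (n , q ++ suc a ∷ zeros j)) ≡ 0
    zero-below-j i i<j =
      trans (typeOf-ancestor i (suc (j ∸ suc i)) (trans (+-suc i (j ∸ suc i)) (m+[n∸m]≡n i<j)))
            (lastOr-replicate (suc a) (j ∸ suc i) 0)

nth-replicate : ∀ m (x : Tree) a {c} → nth (replicate m x) a ≡ just c → c ≡ x
nth-replicate (suc m) x zero    refl = refl
nth-replicate (suc m) x (suc a) eq   = nth-replicate m x a eq

at-∷ : ∀ t i q {s} → at t (i ∷ q) ≡ just s → ∃ λ c → nth (children t) i ≡ just c × at c q ≡ just s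
at-∷ (node ts) i q eq with nth ts i
... | just c = c , refl , eq

record LeftmostChain (F : ℕ → Tree) : Set where
  field
    bottom : ∀ r → at (F 0) (0 ∷ r) ≡ nothing
    step   : ∀ i r → at (F (suc i)) (0 ∷ r) ≡ at (F i) r

at-zeros-chain : ∀ {F} → LeftmostChain F → ∀ c n {t} → at (F n) (zeros c) ≡ just t →
  ∃ λ m → n ≡ c + m × t ≡ F m
at-zeros-chain ch zero    n       eq = n , refl , sym (just-injective eq)
at-zeros-chain ch (suc c) zero    eq = case trans (sym (LeftmostChain.bottom ch (zeros c))) eq of λ ()
at-zeros-chain ch (suc c) (suc n) eq
  with at-zeros-chain ch c n (trans (sym (LeftmostChain.step ch n (zeros c))) eq)
... | m , n≡c+m , t≡ = m , cong suc n≡c+m , t≡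

suc-length-replicate-pred : ∀ {A : Set} N (y : A) → 1 ≤ N → suc (length (replicate (N ∸ 1) y)) ≡ N
suc-length-replicate-pred N y 1≤N = trans (cong suc (length-replicate (N ∸ 1))) (m+[n∸m]≡n 1≤N)

Λ-positive : ∀ lam j → 1 ≤ lam 1 → 1 ≤ j → 1 ≤ Λ lam j
Λ-positive lam (suc zero)    λ₁≥1 _ = λ₁≥1
Λ-positive lam (suc (suc j)) λ₁≥1 _ = ≤-trans (Λ-positive lam (suc j) λ₁≥1 (s≤s z≤n)) (m≤m+n _ _)

module _ (lam : ℕ → ℕ) (k : ℕ) where

  U-chain : LeftmostChain (U lam k)
  U-chain = record { bottom = λ _ → refl ; step = λ _ _ → refl }

  spine-chain : ∀ j → LeftmostChain (spine lam j)
  spine-chain j = record { bottom = λ _ → refl ; step = λ _ _ → refl }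

  data Canonical : Tree → Set where
    U-canonical     : ∀ n → Canonical (U lam k n)
    spine-canonical : ∀ j i → Canonical (spine lam j i)

  nonleftmost-child-Tj : ∀ {t c} → Canonical t → ∀ a → nth (children t) (suc a) ≡ just c →
    ∃ λ m → c ≡ Tj lam m
  nonleftmost-child-Tj (U-canonical (suc n)) a eq =
    n , nth-replicate (Λ lam k ∸ 1) (Tj lam n) a eq
  nonleftmost-child-Tj (spine-canonical j (suc i)) a eq =
    i , nth-replicate (Λ lam (j ∸ i) ∸ 1) (Tj lam i) a eq

  child-canonical : ∀ {t c} → Canonical t → ∀ i → nth (children t) i ≡ just c → Canonical c
  child-canonical (U-canonical (suc n))       zero refl = U-canonical n
  child-canonical (spine-canonical j (suc i)) zero refl = spine-canonical j i
  child-canonical can (suc a) eq with nonleftmost-child-Tj can a eq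
  ... | m , refl = spine-canonical m m

  at-past-nonzero : ∀ {t s} → Canonical t → ∀ q a r → at t (q ++ suc a ∷ r) ≡ just s →
    ∃ λ m → at (Tj lam m) r ≡ just s
  at-past-nonzero {t} can [] a r eq with at-∷ t (suc a) r eq
  ... | c , nth≡ , at≡ with nonleftmost-child-Tj can a nth≡
  ... | m , refl = m , at≡
  at-past-nonzero {t} can (i ∷ q) a r eq with at-∷ t i (q ++ suc a ∷ r) eq
  ... | c , nth≡ , at≡ = at-past-nonzero (child-canonical can i nth≡) q a r at≡

  numChildren-Tj-zeros : 1 ≤ lam 1 → ∀ m j {t} → at (Tj lam m) (zeros j) ≡ just t →
    ¬ (numChildren t ≡ 0) → numChildren t ≡ Λ lam (suc j)
  numChildren-Tj-zeros λ₁≥1 m j eq nonleaf with at-zeros-chain (spine-chain m) j m eq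
  ... | zero  , _    , refl = ⊥-elim (nonleaf refl)
  ... | suc r , refl , refl rewrite +-suc j r | m+n∸n≡m (suc j) r =
    suc-length-replicate-pred (Λ lam (suc j)) (Tj lam r) (Λ-positive lam (suc j) λ₁≥1 (s≤s z≤n))

  supernode-numChildren : 1 ≤ Λ lam k → ∀ n p t → at (U lam k n) p ≡ just t →
    IsSupernode (n , p) → numChildren t ≡ Λ lam k
  supernode-numChildren Λ≥1 n p t eq sup with isSupernode⇒zeros sup
  ... | c , zero  , _    , _    , ()
  ... | c , suc m , refl , refl , _ with at-zeros-chain U-chain c (c + suc m) eq
  ... | m′ , c+m≡c+m′ , refl with +-cancelˡ-≡ c (suc m) m′ c+m≡c+m′
  ... | refl = suc-length-replicate-pred (Λ lam k) (Tj lam m) Λ≥1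

  nonsupernode-numChildren : 1 ≤ lam 1 → ∀ n p t → at (U lam k n) p ≡ just t →
    ¬ (numChildren t ≡ 0) → ¬ IsSupernode (n , p) →
    ∃ λ j → NearestNonZeroDist (n , p) j × numChildren t ≡ Λ lam (suc j)
  nonsupernode-numChildren λ₁≥1 n p t eq nonleaf nonsup with zerosView p
  ... | all-zero c with at-zeros-chain U-chain c n eq
  ...   | zero  , _    , refl = ⊥-elim (nonleaf refl)
  ...   | suc m , refl , refl = ⊥-elim (nonsup (zeros-isSupernode c m))
  nonsupernode-numChildren λ₁≥1 n p t eq nonleaf nonsup | nonzero-then-zeros q a j
    with at-past-nonzero (U-canonical n) q a (zeros j) eq
  ... | m , at≡ = j , nearestNonZeroDist-trailing-zeros n q a j , numChildren-Tj-zeros λ₁≥1 m j at≡ nonleaf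

proposition2p7 : (lam : ℕ → ℕ) (k : ℕ) → Admissible lam k →
    ((n : ℕ) (p : List ℕ) (t : Tree) → at (U lam k n) p ≡ just t →
      IsSupernode (n , p) → numChildren t ≡ Λ lam k)
    ×
    ((n : ℕ) (p : List ℕ) (t : Tree) → at (U lam k n) p ≡ just t →
      ¬ (numChildren t ≡ 0) → ¬ IsSupernode (n , p) →
      ∃ λ j → NearestNonZeroDist (n , p) j × numChildren t ≡ Λ lam (suc j))
proposition2p7 lam k adm =
  supernode-numChildren lam k (Λ-positive lam k λ₁≥1 k≥1) ,
  nonsupernode-numChildren lam k λ₁≥1
  where open Admissible adm
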